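{- Let $X$ be a cubic $s$-regular graph with $s\in\{1,2\}$ and let $\alpha\in\mathrm{Aut}(X)$ be an involution. (i) If $s=1$, then $\alpha$ fixes no vertex (i.e. $\alpha$ is semiregular). (ii) If $s=2$, then every $\alpha$-rigid cell is an $I$-tree.
   Context: Graphs are finite, simple, connected. An $s$-arc is a sequence $(u_0,\dots,u_s)$ of distinct vertices with $u_i$ adjacent to $u_{i+1}$. A cubic graph $X$ is $s$-regular if $\mathrm{Aut}(X)$ acts regularly (transitively with trivial stabilizers) on its $s$-arcs. For an automorphism $\alpha$ with nonempty fixed-vertex set $\mathrm{Fix}(\alpha)$, the $\alpha$-rigid cells are the connected components of the subgraph induced on $\mathrm{Fix}(\alpha)$. An $I$-tree is a graph consisting of a single edge. -}

module Defs where

open import Data.Nat using (ℕ; suc)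
open import Data.Bool using (Bool; true; false)
open import Data.Fin using (Fin; suc; inject₁)
open import Data.Fin.Permutation using (Permutation′; _⟨$⟩ʳ_)
open import Data.List using (length; filter; allFin)
open import Data.Vec using (Vec; lookup; map)
open import Data.Product using (Σ; ∃; ∃-syntax; _×_)
open import Data.Sum using (_⊎_)
open import Relation.Nullary using (¬_)
open import Relation.Binary.PropositionalEquality using (_≡_; _≢_)
open import Function.Bundles using (_⇔_)

record Graph (n : ℕ) : Set where
  field
    adj    : Fin n → Fin n → Bool
    sym    : ∀ u v → adj u v ≡ adj v u
    irrefl : ∀ v → adj v v ≡ false

module _ {n : ℕ} (X : Graph n) where
  open Graph X

  Adj : Fin n → Fin n → Set
  Adj u v = adj u v ≡ true

  data ReachWithin (P : Fin n → Set) : Fin n → Fin n → Set where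
    here : ∀ {v} → P v → ReachWithin P v v
    step : ∀ {u w v} → P u → Adj u w → ReachWithin P w v → ReachWithin P u v

  Connected : Set
  Connected = ∀ u v → ReachWithin (λ _ → Data.Unit.⊤) u v
    where import Data.Unit

  Cubic : Set
  Cubic = ∀ v → length (filter (λ w → Data.Bool._≟_ (adj v w) true) (allFin n)) ≡ 3
    where import Data.Bool

  IsAut : Permutation′ n → Set
  IsAut σ = ∀ u v → adj (σ ⟨$⟩ʳ u) (σ ⟨$⟩ʳ v) ≡ adj u v

  Aut : Set
  Aut = Σ (Permutation′ n) IsAut

  app : Aut → Fin n → Fin n
  app (σ Data.Product., _) v = σ ⟨$⟩ʳ v

  IsArc : (s : ℕ) → Vec (Fin n) (suc s) → Set
  IsArc s a = (∀ i j → i ≢ j → lookup a i ≢ lookup a j)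
            × (∀ (i : Fin s) → Adj (lookup a (inject₁ i)) (lookup a (suc i)))

  SRegular : ℕ → Set
  SRegular s =
      (∀ a b → IsArc s a → IsArc s b → ∃[ σ ] map (app σ) a ≡ b)
    × (∀ σ a → IsArc s a → map (app σ) a ≡ a → ∀ v → app σ v ≡ v)

  Involution : Aut → Set
  Involution α = (∀ v → app α (app α v) ≡ v) × ¬ (∀ v → app α v ≡ v)

  Fixed : Aut → Fin n → Set
  Fixed α v = app α v ≡ v

  -- the α-rigid cell containing a fixed vertex v: the connected component
  -- of v in the subgraph induced on Fix(α)
  RigidCell : Aut → Fin n → Fin n → Set
  RigidCell α v u = ReachWithin (Fixed α) v u

  IsITree : (Fin n → Set) → Set
  IsITree S = ∃[ a ] ∃[ b ] (a ≢ b × Adj a b × (∀ u → S u ⇔ (u ≡ a ⊎ u ≡ b)))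

module Submission where

-- The argument rests on two facts.
--  * Fixed vertices have fixed neighbours: α permutes the three neighbours
--    of a fixed vertex, and an involution of a three-element set has a
--    fixed point (`involution-fixes-one-of-three`, `fixed-neighbour`).
--  * Regularity on s-arcs means an automorphism fixing an s-arc pointwise
--    is the identity, so a (non-trivial) involution fixes no s-arc
--    (`no-fixed-arc`); we use it for 1-arcs and 2-arcs.
-- For s = 1 a fixed vertex v would give a fixed neighbour w, i.e. a fixed
-- 1-arc (v, w). For s = 2 a fixed vertex v has a fixed neighbour w, and no
-- third fixed vertex can be adjacent to v or w (it would complete a fixed
-- 2-arc); since walks through fixed vertices stay inside any set closed
-- under fixed neighbours (`reach-preserves`), the rigid cell of v is {v, w}.

open import Defs
open import Data.Nat using (ℕ)
open import Data.Fin using (Fin; zero; suc) renaming (_≟_ to _≟ᶠ_)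
open import Data.Bool using (true) renaming (_≟_ to _≟ᵇ_)
open import Data.List using (List; []; _∷_; length; filter; allFin)
open import Data.List.Membership.Propositional using (_∈_)
open import Data.List.Membership.Propositional.Properties using (∈-filter⁺; ∈-filter⁻; ∈-allFin)
open import Data.List.Relation.Unary.Any using (here; there)
open import Data.List.Relation.Unary.Unique.Propositional using (Unique)
open import Data.List.Relation.Unary.AllPairs using ([]; _∷_)
open import Data.List.Relation.Unary.All using ([]; _∷_)
import Data.List.Relation.Unary.Unique.Propositional.Properties as Unique
open import Data.Vec using (Vec; []; _∷_; lookup; map)
open import Data.Product using (Σ; _×_; _,_; proj₂)
open import Data.Sum using (_⊎_; inj₁; inj₂)
open import Data.Empty using (⊥; ⊥-elim)
open import Relation.Nullary using (yes; no)
open import Relation.Binary.PropositionalEquality using (_≡_; _≢_; refl; sym; trans; cong; cong₂)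
open import Function.Bundles using (mk⇔)

module _ {A : Set} (f : A → A) (involutive : ∀ x → f (f x) ≡ x) where

  involution-injective : ∀ {x y} → f x ≡ f y → x ≡ y
  involution-injective {x} {y} fx≡fy =
    trans (sym (involutive x)) (trans (cong f fx≡fy) (involutive y))

  -- An involution mapping a three-element set into itself fixes one of its
  -- points: its orbits have size 1 or 2, and 3 is odd.  Concretely, if the
  -- first point a is not fixed, f swaps it with b or c, and the remaining
  -- point can go nowhere but to itself.
  involution-fixes-one-of-three :
    (L : List A) → length L ≡ 3 → Unique L → (∀ u → u ∈ L → f u ∈ L) →
    Σ A λ u → u ∈ L × f u ≡ u
  involution-fixes-one-of-three (a ∷ b ∷ c ∷ []) refl
      ((a≢b ∷ a≢c ∷ []) ∷ (b≢c ∷ []) ∷ [] ∷ []) closed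
    with closed a (here refl)
  ... | here fa≡a = a , here refl , fa≡a
  ... | there (here fa≡b) with closed c (there (there (here refl)))
  ...   | here fc≡a = ⊥-elim (b≢c (trans (sym fa≡b) (trans (cong f (sym fc≡a)) (involutive c))))
  ...   | there (here fc≡b) = ⊥-elim (a≢c (involution-injective (trans fa≡b (sym fc≡b))))
  ...   | there (there (here fc≡c)) = c , there (there (here refl)) , fc≡c
  involution-fixes-one-of-three (a ∷ b ∷ c ∷ []) refl
      ((a≢b ∷ a≢c ∷ []) ∷ (b≢c ∷ []) ∷ [] ∷ []) closed
    | there (there (here fa≡c)) with closed b (there (here refl))
  ...   | here fb≡a = ⊥-elim (b≢c (trans (sym (involutive b)) (trans (cong f fb≡a) fa≡c)))
  ...   | there (here fb≡b) = b , there (here refl) , fb≡b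
  ...   | there (there (here fb≡c)) = ⊥-elim (a≢b (involution-injective (trans fa≡c (sym fb≡c))))

map-fixing-entries : ∀ {A : Set} {k} (f : A → A) (a : Vec A k) →
                     (∀ i → f (lookup a i) ≡ lookup a i) → map f a ≡ a
map-fixing-entries f []      _     = refl
map-fixing-entries f (x ∷ a) fixes =
  cong₂ _∷_ (fixes zero) (map-fixing-entries f a (λ i → fixes (suc i)))

module _ {n : ℕ} (X : Graph n) where
  open Graph X renaming (sym to adj-sym)

  adjacent-distinct : ∀ {u w} → Adj X u w → u ≢ w
  adjacent-distinct {u} u~w refl with trans (sym u~w) (irrefl u)
  ... | ()

  adjacent-sym : ∀ {u w} → Adj X u w → Adj X w u
  adjacent-sym {u} {w} u~w = trans (adj-sym w u) u~w

  reach-start : ∀ {P : Fin n → Set} {p u} → ReachWithin X P p u → P p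
  reach-start (here Pp)     = Pp
  reach-start (step Pp _ _) = Pp

  reach-preserves : ∀ {P S : Fin n → Set} →
                    (∀ {p q} → S p → Adj X p q → P q → S q) →
                    ∀ {p u} → S p → ReachWithin X P p u → S u
  reach-preserves closed Sp (here _)       = Sp
  reach-preserves closed Sp (step _ p~q r) =
    reach-preserves closed (closed Sp p~q (reach-start r)) r

  neighbours : Fin n → List (Fin n)
  neighbours v = filter (λ w → adj v w ≟ᵇ true) (allFin n)

  ∈-neighbours⁺ : ∀ {v w} → Adj X v w → w ∈ neighbours v
  ∈-neighbours⁺ {v} v~w = ∈-filter⁺ (λ w → adj v w ≟ᵇ true) (∈-allFin _) v~w

  ∈-neighbours⁻ : ∀ {v w} → w ∈ neighbours v → Adj X v w
  ∈-neighbours⁻ {v} w∈N = proj₂ (∈-filter⁻ (λ w → adj v w ≟ᵇ true) {xs = allFin n} w∈N)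

  fixed-preserves-neighbours : ∀ (α : Aut X) {v} → Fixed X α v →
                               ∀ u → u ∈ neighbours v → app X α u ∈ neighbours v
  fixed-preserves-neighbours α {v} αv≡v u u∈N =
    ∈-neighbours⁺ (trans (cong (λ z → adj z (app X α u)) (sym αv≡v))
                         (trans (proj₂ α v u) (∈-neighbours⁻ u∈N)))

  fixed-neighbour : Cubic X → ∀ (α : Aut X) → Involution X α →
                    ∀ v → Fixed X α v → Σ (Fin n) λ w → Adj X v w × Fixed X α w
  fixed-neighbour cubic α (involutive , _) v αv≡v
    with involution-fixes-one-of-three (app X α) involutive (neighbours v) (cubic v)
           (Unique.filter⁺ (λ w → adj v w ≟ᵇ true) (Unique.allFin⁺ n))
           (fixed-preserves-neighbours α αv≡v)
  ... | w , w∈N , αw≡w = w , ∈-neighbours⁻ w∈N , αw≡w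

  no-fixed-arc : ∀ {s} → SRegular X s → ∀ (α : Aut X) → Involution X α →
                 ∀ a → IsArc X s a → (∀ i → Fixed X α (lookup a i)) → ⊥
  no-fixed-arc (_ , stabiliser-trivial) α (_ , α≢id) a arc fixes =
    α≢id (stabiliser-trivial α a arc (map-fixing-entries (app X α) a fixes))

  edge-arc : ∀ {v w} → Adj X v w → IsArc X 1 (v ∷ w ∷ [])
  edge-arc {v} {w} v~w = distinct , λ { zero → v~w }
    where
      distinct : ∀ i j → i ≢ j → lookup (v ∷ w ∷ []) i ≢ lookup (v ∷ w ∷ []) j
      distinct zero       zero       i≢j = ⊥-elim (i≢j refl)
      distinct zero       (suc zero) _   = adjacent-distinct v~w
      distinct (suc zero) zero       _   = adjacent-distinct (adjacent-sym v~w)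
      distinct (suc zero) (suc zero) i≢j = ⊥-elim (i≢j refl)

  path-arc : ∀ {x v w} → Adj X x v → Adj X v w → x ≢ w → IsArc X 2 (x ∷ v ∷ w ∷ [])
  path-arc {x} {v} {w} x~v v~w x≢w = distinct , λ { zero → x~v ; (suc zero) → v~w }
    where
      distinct : ∀ i j → i ≢ j → lookup (x ∷ v ∷ w ∷ []) i ≢ lookup (x ∷ v ∷ w ∷ []) j
      distinct zero             zero             i≢j = ⊥-elim (i≢j refl)
      distinct zero             (suc zero)       _   = adjacent-distinct x~v
      distinct zero             (suc (suc zero)) _   = x≢w
      distinct (suc zero)       zero             _   = adjacent-distinct (adjacent-sym x~v)
      distinct (suc zero)       (suc zero)       i≢j = ⊥-elim (i≢j refl)
      distinct (suc zero)       (suc (suc zero)) _   = adjacent-distinct v~w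
      distinct (suc (suc zero)) zero             _   = λ w≡x → x≢w (sym w≡x)
      distinct (suc (suc zero)) (suc zero)       _   = adjacent-distinct (adjacent-sym v~w)
      distinct (suc (suc zero)) (suc (suc zero)) i≢j = ⊥-elim (i≢j refl)

  module _ (α : Aut X) (inv : Involution X α) where

    no-fixed-edge : SRegular X 1 → ∀ {v w} → Adj X v w →
                    Fixed X α v → Fixed X α w → ⊥
    no-fixed-edge reg {v} {w} v~w αv≡v αw≡w =
      no-fixed-arc reg α inv (v ∷ w ∷ []) (edge-arc v~w) λ { zero → αv≡v ; (suc zero) → αw≡w }

    fixed-edge-maximal : SRegular X 2 → ∀ {v w x} → Adj X v w → Adj X v x →
                         Fixed X α v → Fixed X α w → Fixed X α x → x ≡ w
    fixed-edge-maximal reg {v} {w} {x} v~w v~x αv≡v αw≡w αx≡x with x ≟ᶠ w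
    ... | yes x≡w = x≡w
    ... | no  x≢w = ⊥-elim (no-fixed-arc reg α inv (x ∷ v ∷ w ∷ []) (path-arc (adjacent-sym v~x) v~w x≢w)
                              λ { zero → αx≡x ; (suc zero) → αv≡v ; (suc (suc zero)) → αw≡w })

    rigid-cell-is-edge : SRegular X 2 → ∀ {v w} → Adj X v w →
                         Fixed X α v → Fixed X α w → IsITree X (RigidCell X α v)
    rigid-cell-is-edge reg {v} {w} v~w αv≡v αw≡w =
      v , w , adjacent-distinct v~w , v~w ,
      λ u → mk⇔ (reach-preserves stays-in-edge (inj₁ refl)) in-cell
      where
        stays-in-edge : ∀ {p q} → (p ≡ v ⊎ p ≡ w) → Adj X p q → Fixed X α q →
                        (q ≡ v ⊎ q ≡ w)
        stays-in-edge (inj₁ refl) p~q αq≡q =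
          inj₂ (fixed-edge-maximal reg v~w p~q αv≡v αw≡w αq≡q)
        stays-in-edge (inj₂ refl) p~q αq≡q =
          inj₁ (fixed-edge-maximal reg (adjacent-sym v~w) p~q αw≡w αv≡v αq≡q)

        in-cell : ∀ {u} → (u ≡ v ⊎ u ≡ w) → RigidCell X α v u
        in-cell (inj₁ refl) = here αv≡v
        in-cell (inj₂ refl) = step αv≡v v~w (here αw≡w)

proposition3p2 : {n : ℕ} (X : Graph n) → Connected X → Cubic X → (α : Aut X) → Involution X α
    → ((SRegular X 1 → ∀ v → app X α v ≢ v)
    × (SRegular X 2 → ∀ v → Fixed X α v → IsITree X (RigidCell X α v)))
proposition3p2 X _ cubic α inv = semiregular , rigid-cells
  where
    semiregular : SRegular X 1 → ∀ v → app X α v ≢ v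
    semiregular reg v αv≡v =
      let (w , v~w , αw≡w) = fixed-neighbour X cubic α inv v αv≡v
      in  no-fixed-edge X α inv reg v~w αv≡v αw≡w

    rigid-cells : SRegular X 2 → ∀ v → Fixed X α v → IsITree X (RigidCell X α v)
    rigid-cells reg v αv≡v =
      let (w , v~w , αw≡w) = fixed-neighbour X cubic α inv v αv≡v
      in  rigid-cell-is-edge X α inv reg v~w αv≡v αw≡w
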